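{- The three operations $\triangleleft,\circ,\triangleright$ endow $K\langle A\rangle^+$ with the structure of a dendriform trialgebra.
   Context: $K$ is a field of characteristic $0$; $A=\{a_1<a_2<\cdots\}$ is an infinite totally ordered alphabet, $K\langle A\rangle$ is the projective limit of the free associative algebras $K\langle a_1,\dots,a_n\rangle$, and $K\langle A\rangle^+$ its augmentation ideal (elements without constant term). $\max(w)$ is the greatest letter of a word $w$. For nonempty words $u,v$: $u\triangleleft v=uv$ if $\max(u)>\max(v)$, else $0$; $u\circ v=uv$ if $\max(u)=\max(v)$, else $0$; $u\triangleright v=uv$ if $\max(u)<\max(v)$, else $0$; these are extended bilinearly (termwise on infinite sums). A dendriform trialgebra is a vector space with bilinear operations $\triangleleft,\circ,\triangleright$ such that, with $x\odot y=x\triangleleft y+x\circ y+x\triangleright y$: $\circ$ is associative and $(x\triangleleft y)\triangleleft z=x\triangleleft(y\odot z)$, $(x\triangleright y)\triangleleft z=x\triangleright(y\triangleleft z)$, $(x\odot y)\triangleright z=x\triangleright(y\triangleright z)$, $(x\triangleright y)\circ z=x\triangleright(y\circ z)$, $(x\triangleleft y)\circ z=x\circ(y\triangleright z)$, $(x\circ y)\triangleleft z=x\circ(y\triangleleft z)$. -}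

module Defs where

open import Level using (Level; _⊔_) renaming (suc to lsuc)
open import Data.Nat as ℕ using (ℕ; zero; suc; _<ᵇ_; _≡ᵇ_)
open import Data.Bool using (Bool; true; false; if_then_else_; _∧_; not)
open import Data.List using (List; []; _∷_; map; foldr; length; null)
open import Data.List.Relation.Unary.All using (All)
open import Data.Product using (_×_; _,_; proj₁; proj₂; ∃-syntax)
open import Relation.Nullary using (¬_)
open import Relation.Binary.PropositionalEquality using (_≡_)
open import Algebra.Bundles using (CommutativeRing)

record IsField {c ℓ : Level} (K : CommutativeRing c ℓ) : Set (c ⊔ ℓ) where
  open CommutativeRing K
  field
    1≉0     : ¬ (1# ≈ 0#)
    inverse : ∀ x → ¬ (x ≈ 0#) → ∃[ y ] (x * y ≈ 1#)

module _ {c ℓ : Level} (K : CommutativeRing c ℓ) where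
  open CommutativeRing K

  natK : ℕ → Carrier
  natK zero    = 0#
  natK (suc n) = 1# + natK n

  CharZero : Set ℓ
  CharZero = ∀ n → natK n ≈ 0# → n ≡ 0

-- The alphabet A = {a_0 < a_1 < a_2 < ...} is identified with ℕ (letter a_i ↦ i);
-- words are lists of letters.
Word : Set
Word = List ℕ

-- greatest letter of a word (only used on nonempty words)
maxW : Word → ℕ
maxW = foldr ℕ._⊔_ 0

splits : Word → List (Word × Word)
splits []       = ([] , []) ∷ []
splits (x ∷ xs) = ([] , x ∷ xs) ∷ map (λ p → (x ∷ proj₁ p , proj₂ p)) (splits xs)

nonempty : Word → Bool
nonempty w = not (null w)

condL condC condR : Word → Word → Bool
condL u v = nonempty u ∧ nonempty v ∧ (maxW v <ᵇ maxW u)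
condC u v = nonempty u ∧ nonempty v ∧ (maxW u ≡ᵇ maxW v)
condR u v = nonempty u ∧ nonempty v ∧ (maxW u <ᵇ maxW v)

module Series {c ℓ : Level} (K : CommutativeRing c ℓ) where
  open CommutativeRing K

  -- an element of K⟨A⟩ (projective limit) is given by its coefficient function
  Ser : Set c
  Ser = Word → Carrier

  _≈S_ : Ser → Ser → Set ℓ
  f ≈S g = ∀ w → f w ≈ g w

  0S : Ser
  0S _ = 0#

  _+S_ : Ser → Ser → Ser
  (f +S g) w = f w + g w

  _·S_ : Carrier → Ser → Ser
  (k ·S f) w = k * f w

  sumK : List Carrier → Carrier
  sumK = foldr _+_ 0#

  -- bilinear (termwise) extension of a word operation u ⋆ v = [cond u v] uv
  opBy : (Word → Word → Bool) → Ser → Ser → Ser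
  opBy cond f g w =
    sumK (map (λ p → if cond (proj₁ p) (proj₂ p)
                     then f (proj₁ p) * g (proj₂ p) else 0#) (splits w))

  _◁_ _∘_ _▷_ _⊙_ : Ser → Ser → Ser
  _◁_ = opBy condL
  _∘_ = opBy condC
  _▷_ = opBy condR
  x ⊙ y = ((x ◁ y) +S (x ∘ y)) +S (x ▷ y)

  -- membership in the projective limit lim_n K⟨a_0,…,a_{n-1}⟩: for each n the
  -- projection (words over the first n letters) is a polynomial, i.e. has bounded degree
  InLimit : Ser → Set ℓ
  InLimit f = ∀ n → ∃[ d ] (∀ w → All (ℕ._< n) w → d ℕ.< length w → f w ≈ 0#)

  InKA+ : Ser → Set ℓ
  InKA+ f = InLimit f × (f [] ≈ 0#)

  record IsDendriformTrialgebraOn (P : Ser → Set ℓ)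
                                  (_◁'_ _∘'_ _▷'_ : Ser → Ser → Ser)
                                  : Set (c ⊔ ℓ) where
    _⊙'_ : Ser → Ser → Ser
    x ⊙' y = ((x ◁' y) +S (x ∘' y)) +S (x ▷' y)
    field
      P-0     : P 0S
      P-+     : ∀ {x y} → P x → P y → P (x +S y)
      P-·     : ∀ k {x} → P x → P (k ·S x)
      P-◁     : ∀ {x y} → P x → P y → P (x ◁' y)
      P-∘     : ∀ {x y} → P x → P y → P (x ∘' y)
      P-▷     : ∀ {x y} → P x → P y → P (x ▷' y)
      ◁-cong  : ∀ {x x' y y'} → x ≈S x' → y ≈S y' → (x ◁' y) ≈S (x' ◁' y')
      ∘-cong  : ∀ {x x' y y'} → x ≈S x' → y ≈S y' → (x ∘' y) ≈S (x' ∘' y')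
      ▷-cong  : ∀ {x x' y y'} → x ≈S x' → y ≈S y' → (x ▷' y) ≈S (x' ▷' y')
      ◁-linˡ  : ∀ a b x y z → P x → P y → P z →
                  (((a ·S x) +S (b ·S y)) ◁' z) ≈S ((a ·S (x ◁' z)) +S (b ·S (y ◁' z)))
      ◁-linʳ  : ∀ a b x y z → P x → P y → P z →
                  (z ◁' ((a ·S x) +S (b ·S y))) ≈S ((a ·S (z ◁' x)) +S (b ·S (z ◁' y)))
      ∘-linˡ  : ∀ a b x y z → P x → P y → P z →
                  (((a ·S x) +S (b ·S y)) ∘' z) ≈S ((a ·S (x ∘' z)) +S (b ·S (y ∘' z)))
      ∘-linʳ  : ∀ a b x y z → P x → P y → P z →
                  (z ∘' ((a ·S x) +S (b ·S y))) ≈S ((a ·S (z ∘' x)) +S (b ·S (z ∘' y)))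
      ▷-linˡ  : ∀ a b x y z → P x → P y → P z →
                  (((a ·S x) +S (b ·S y)) ▷' z) ≈S ((a ·S (x ▷' z)) +S (b ·S (y ▷' z)))
      ▷-linʳ  : ∀ a b x y z → P x → P y → P z →
                  (z ▷' ((a ·S x) +S (b ·S y))) ≈S ((a ·S (z ▷' x)) +S (b ·S (z ▷' y)))
      ∘-assoc : ∀ x y z → P x → P y → P z → ((x ∘' y) ∘' z) ≈S (x ∘' (y ∘' z))
      ax1     : ∀ x y z → P x → P y → P z → ((x ◁' y) ◁' z) ≈S (x ◁' (y ⊙' z))
      ax2     : ∀ x y z → P x → P y → P z → ((x ▷' y) ◁' z) ≈S (x ▷' (y ◁' z))
      ax3     : ∀ x y z → P x → P y → P z → ((x ⊙' y) ▷' z) ≈S (x ▷' (y ▷' z))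
      ax4     : ∀ x y z → P x → P y → P z → ((x ▷' y) ∘' z) ≈S (x ▷' (y ∘' z))
      ax5     : ∀ x y z → P x → P y → P z → ((x ◁' y) ∘' z) ≈S (x ∘' (y ▷' z))
      ax6     : ∀ x y z → P x → P y → P z → ((x ∘' y) ◁' z) ≈S (x ∘' (y ◁' z))

-- Each of ◁, ∘, ▷ sums x(a) y(b) over the factorisations w = a b whose maxima
-- max a, max b stand in a prescribed order. An iterated product therefore sums
-- x(a₁) y(a₂) z(b) over the factorisations w = a₁ a₂ b, and since
-- max (a₁ a₂) = max a₁ ⊔ max a₂, each trialgebra axiom reduces to an identity
-- between order conditions on three natural numbers.
module Submission where

open import Defs
open import Level using (Level)
open import Algebra.Bundles using (CommutativeRing)
open import Data.Nat as ℕ using (ℕ; zero; suc; _<ᵇ_; _≡ᵇ_; _⊔_; _<?_)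
import Data.Nat.Properties as ℕP
open import Data.Bool using (Bool; true; false; _∧_; _∨_; if_then_else_)
open import Data.Bool.Properties using (∧-zeroʳ; ∧-identityʳ)
open import Data.List using ([]; _∷_; _++_; map; length)
import Data.List.Properties as ListP
open import Data.List.Relation.Unary.All using (All)
import Data.List.Relation.Unary.All.Properties as AllP
open import Data.Product using (_×_; _,_; proj₁; proj₂)
open import Data.Empty using (⊥-elim)
open import Function using (_∘′_)
open import Relation.Nullary using (yes; no)
import Relation.Binary.PropositionalEquality as ≡
open ≡ using (_≡_)

maxW-++ : ∀ u v → maxW (u ++ v) ≡ maxW u ⊔ maxW v
maxW-++ []      v = ≡.refl
maxW-++ (x ∷ u) v = ≡.trans (≡.cong (x ⊔_) (maxW-++ u v)) (≡.sym (ℕP.⊔-assoc x (maxW u) (maxW v)))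

nonempty-++ : ∀ u v → nonempty (u ++ v) ≡ nonempty u ∨ nonempty v
nonempty-++ []      v = ≡.refl
nonempty-++ (x ∷ u) v = ≡.refl

byMax : (ℕ → ℕ → Bool) → Word → Word → Bool
byMax r u v = nonempty u ∧ nonempty v ∧ r (maxW u) (maxW v)

_>ᵇ_ always : ℕ → ℕ → Bool
m >ᵇ n = n <ᵇ m
always _ _ = true

AssocCompatible : (c₁ c₂ c₃ c₄ : Word → Word → Bool) → Set
AssocCompatible c₁ c₂ c₃ c₄ =
  ∀ a₁ a₂ b → c₂ (a₁ ++ a₂) b ∧ c₁ a₁ a₂ ≡ c₃ a₁ (a₂ ++ b) ∧ c₄ a₂ b

MaxCompatible : (r₁ r₂ r₃ r₄ : ℕ → ℕ → Bool) → Set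
MaxCompatible r₁ r₂ r₃ r₄ =
  ∀ m₁ m₂ m₃ → r₂ (m₁ ⊔ m₂) m₃ ∧ r₁ m₁ m₂ ≡ r₃ m₁ (m₂ ⊔ m₃) ∧ r₄ m₂ m₃

nonempty-guards-agree : ∀ n₁ n₂ n₃ p q p′ q′ → p ∧ q ≡ p′ ∧ q′ →
  ((n₁ ∨ n₂) ∧ n₃ ∧ p) ∧ (n₁ ∧ n₂ ∧ q) ≡ (n₁ ∧ (n₂ ∨ n₃) ∧ p′) ∧ (n₂ ∧ n₃ ∧ q′)
nonempty-guards-agree true  true  true  p q p′ q′ e = e
nonempty-guards-agree true  true  false p q p′ q′ e = ≡.sym (∧-zeroʳ p′)
nonempty-guards-agree true  false true  p q p′ q′ e = ≡.trans (∧-zeroʳ p) (≡.sym (∧-zeroʳ p′))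
nonempty-guards-agree true  false false p q p′ q′ e = ≡.refl
nonempty-guards-agree false true  true  p q p′ q′ e = ∧-zeroʳ p
nonempty-guards-agree false true  false p q p′ q′ e = ≡.refl
nonempty-guards-agree false false n₃    p q p′ q′ e = ≡.refl

byMax-assocCompatible : ∀ r₁ r₂ r₃ r₄ → MaxCompatible r₁ r₂ r₃ r₄ →
  AssocCompatible (byMax r₁) (byMax r₂) (byMax r₃) (byMax r₄)
byMax-assocCompatible _ _ _ _ compat a₁ a₂ b
  rewrite nonempty-++ a₁ a₂ | maxW-++ a₁ a₂ | nonempty-++ a₂ b | maxW-++ a₂ b
  = nonempty-guards-agree (nonempty a₁) (nonempty a₂) (nonempty b) _ _ _ _
      (compat (maxW a₁) (maxW a₂) (maxW b))

maxCompatible-∘-assoc : MaxCompatible _≡ᵇ_ _≡ᵇ_ _≡ᵇ_ _≡ᵇ_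
maxCompatible-∘-assoc zero    zero    zero    = ≡.refl
maxCompatible-∘-assoc zero    zero    (suc _) = ≡.refl
maxCompatible-∘-assoc zero    (suc _) zero    = ≡.refl
maxCompatible-∘-assoc zero    (suc _) (suc _) = ∧-zeroʳ _
maxCompatible-∘-assoc (suc _) zero    zero    = ≡.refl
maxCompatible-∘-assoc (suc _) zero    (suc _) = ≡.refl
maxCompatible-∘-assoc (suc _) (suc _) zero    = ≡.sym (∧-zeroʳ _)
maxCompatible-∘-assoc (suc l) (suc m) (suc n) = maxCompatible-∘-assoc l m n

maxCompatible-ax1 : MaxCompatible _>ᵇ_ _>ᵇ_ _>ᵇ_ always
maxCompatible-ax1 zero    zero    zero    = ≡.refl
maxCompatible-ax1 zero    zero    (suc _) = ≡.refl
maxCompatible-ax1 zero    (suc _) zero    = ≡.refl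
maxCompatible-ax1 zero    (suc _) (suc _) = ∧-zeroʳ _
maxCompatible-ax1 (suc _) zero    zero    = ≡.refl
maxCompatible-ax1 (suc _) zero    (suc _) = ≡.refl
maxCompatible-ax1 (suc _) (suc _) zero    = ≡.sym (∧-identityʳ _)
maxCompatible-ax1 (suc l) (suc m) (suc n) = maxCompatible-ax1 l m n

maxCompatible-ax2 : MaxCompatible _<ᵇ_ _>ᵇ_ _<ᵇ_ _>ᵇ_
maxCompatible-ax2 zero    zero    zero    = ≡.refl
maxCompatible-ax2 zero    zero    (suc _) = ≡.refl
maxCompatible-ax2 zero    (suc _) zero    = ≡.refl
maxCompatible-ax2 zero    (suc _) (suc _) = ∧-identityʳ _
maxCompatible-ax2 (suc _) zero    zero    = ≡.refl
maxCompatible-ax2 (suc _) zero    (suc _) = ≡.trans (∧-zeroʳ _) (≡.sym (∧-zeroʳ _))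
maxCompatible-ax2 (suc _) (suc _) zero    = ≡.sym (∧-identityʳ _)
maxCompatible-ax2 (suc l) (suc m) (suc n) = maxCompatible-ax2 l m n

maxCompatible-ax3 : MaxCompatible always _<ᵇ_ _<ᵇ_ _<ᵇ_
maxCompatible-ax3 zero    zero    zero    = ≡.refl
maxCompatible-ax3 zero    zero    (suc _) = ≡.refl
maxCompatible-ax3 zero    (suc _) zero    = ≡.refl
maxCompatible-ax3 zero    (suc _) (suc _) = ∧-identityʳ _
maxCompatible-ax3 (suc _) zero    zero    = ≡.refl
maxCompatible-ax3 (suc _) zero    (suc _) = ≡.refl
maxCompatible-ax3 (suc _) (suc _) zero    = ≡.sym (∧-zeroʳ _)
maxCompatible-ax3 (suc l) (suc m) (suc n) = maxCompatible-ax3 l m n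

maxCompatible-ax4 : MaxCompatible _<ᵇ_ _≡ᵇ_ _<ᵇ_ _≡ᵇ_
maxCompatible-ax4 zero    zero    zero    = ≡.refl
maxCompatible-ax4 zero    zero    (suc _) = ≡.refl
maxCompatible-ax4 zero    (suc _) zero    = ≡.refl
maxCompatible-ax4 zero    (suc _) (suc _) = ∧-identityʳ _
maxCompatible-ax4 (suc _) zero    zero    = ≡.refl
maxCompatible-ax4 (suc _) zero    (suc _) = ≡.trans (∧-zeroʳ _) (≡.sym (∧-zeroʳ _))
maxCompatible-ax4 (suc _) (suc _) zero    = ≡.sym (∧-zeroʳ _)
maxCompatible-ax4 (suc l) (suc m) (suc n) = maxCompatible-ax4 l m n

maxCompatible-ax5 : MaxCompatible _>ᵇ_ _≡ᵇ_ _≡ᵇ_ _<ᵇ_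
maxCompatible-ax5 zero    zero    zero    = ≡.refl
maxCompatible-ax5 zero    zero    (suc _) = ≡.refl
maxCompatible-ax5 zero    (suc _) zero    = ≡.refl
maxCompatible-ax5 zero    (suc _) (suc _) = ∧-zeroʳ _
maxCompatible-ax5 (suc _) zero    zero    = ≡.refl
maxCompatible-ax5 (suc _) zero    (suc _) = ≡.refl
maxCompatible-ax5 (suc _) (suc _) zero    = ≡.sym (∧-zeroʳ _)
maxCompatible-ax5 (suc l) (suc m) (suc n) = maxCompatible-ax5 l m n

maxCompatible-ax6 : MaxCompatible _≡ᵇ_ _>ᵇ_ _≡ᵇ_ _>ᵇ_
maxCompatible-ax6 zero    zero    zero    = ≡.refl
maxCompatible-ax6 zero    zero    (suc _) = ≡.refl
maxCompatible-ax6 zero    (suc _) zero    = ≡.refl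
maxCompatible-ax6 zero    (suc _) (suc _) = ∧-zeroʳ _
maxCompatible-ax6 (suc _) zero    zero    = ≡.refl
maxCompatible-ax6 (suc _) zero    (suc _) = ≡.trans (∧-zeroʳ _) (≡.sym (∧-zeroʳ _))
maxCompatible-ax6 (suc _) (suc _) zero    = ≡.sym (∧-identityʳ _)
maxCompatible-ax6 (suc l) (suc m) (suc n) = maxCompatible-ax6 l m n

module SeriesProperties {c ℓ : Level} (K : CommutativeRing c ℓ) where
  open CommutativeRing K
  open Series K
  open import Algebra.Properties.CommutativeSemigroup +-commutativeSemigroup
    using () renaming (interchange to +-interchange)
  open import Relation.Binary.Reasoning.Setoid setoid

  when : Bool → Carrier → Carrier
  when b X = if b then X else 0#

  when-cong : ∀ b {X Y} → X ≈ Y → when b X ≈ when b Y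
  when-cong true  e = e
  when-cong false e = refl

  when-zero : ∀ b {X} → X ≈ 0# → when b X ≈ 0#
  when-zero true  e = e
  when-zero false e = refl

  when-nestˡ : ∀ b d X Y Z → when b (when d (X * Y) * Z) ≈ when (b ∧ d) (X * (Y * Z))
  when-nestˡ true  true  X Y Z = *-assoc X Y Z
  when-nestˡ true  false X Y Z = zeroˡ Z
  when-nestˡ false d     X Y Z = refl

  when-nestʳ : ∀ b d X Y Z → when b (X * when d (Y * Z)) ≈ when (b ∧ d) (X * (Y * Z))
  when-nestʳ true  true  X Y Z = refl
  when-nestʳ true  false X Y Z = zeroʳ X
  when-nestʳ false d     X Y Z = refl

  when-trichotomy : ∀ m n X → (when (m >ᵇ n) X + when (m ≡ᵇ n) X) + when (m <ᵇ n) X ≈ X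
  when-trichotomy zero    zero    X = trans (+-identityʳ _) (+-identityˡ X)
  when-trichotomy zero    (suc n) X = trans (+-cong (+-identityʳ 0#) refl) (+-identityˡ X)
  when-trichotomy (suc m) zero    X = trans (+-identityʳ _) (+-identityʳ X)
  when-trichotomy (suc m) (suc n) X = when-trichotomy m n X

  -- The trailing 0# mirrors sumK, so that opBy unfolds to ∑splits.
  ∑splits : Word → (Word → Word → Carrier) → Carrier
  ∑splits []       F = F [] [] + 0#
  ∑splits (x ∷ xs) F = F [] (x ∷ xs) + ∑splits xs (λ a b → F (x ∷ a) b)

  opBy-∑splits : ∀ cond f g w → opBy cond f g w ≡ ∑splits w (λ a b → when (cond a b) (f a * g b))
  opBy-∑splits cond f g w = sumK-map-splits w _
    where
    sumK-map-splits : ∀ w (h : Word × Word → Carrier) → sumK (map h (splits w)) ≡ ∑splits w (λ a b → h (a , b))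
    sumK-map-splits []       h = ≡.refl
    sumK-map-splits (x ∷ xs) h = ≡.cong (h ([] , x ∷ xs) +_)
      (≡.trans (≡.cong sumK (≡.sym (ListP.map-∘ (splits xs))))
               (sumK-map-splits xs (λ p → h (x ∷ proj₁ p , proj₂ p))))

  ∑splits-cong-on : ∀ w {F G} → (∀ a b → a ++ b ≡ w → F a b ≈ G a b) → ∑splits w F ≈ ∑splits w G
  ∑splits-cong-on []       e = +-cong (e [] [] ≡.refl) refl
  ∑splits-cong-on (x ∷ xs) e =
    +-cong (e [] (x ∷ xs) ≡.refl) (∑splits-cong-on xs (λ a b ab≡xs → e (x ∷ a) b (≡.cong (x ∷_) ab≡xs)))

  ∑splits-cong : ∀ w {F G} → (∀ a b → F a b ≈ G a b) → ∑splits w F ≈ ∑splits w G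
  ∑splits-cong w e = ∑splits-cong-on w (λ a b _ → e a b)

  ∑splits-++ : ∀ w (F : Word → Word → Word → Carrier) → ∑splits w (F w) ≈ ∑splits w (λ a b → F (a ++ b) a b)
  ∑splits-++ w F = ∑splits-cong-on w (λ a b ab≡w → reflexive (≡.cong (λ v → F v a b) (≡.sym ab≡w)))

  ∑splits-0 : ∀ w → ∑splits w (λ _ _ → 0#) ≈ 0#
  ∑splits-0 []       = +-identityʳ 0#
  ∑splits-0 (x ∷ xs) = trans (+-cong refl (∑splits-0 xs)) (+-identityʳ 0#)

  ∑splits-+ : ∀ w F G → ∑splits w (λ a b → F a b + G a b) ≈ ∑splits w F + ∑splits w G
  ∑splits-+ []       F G = trans (+-cong refl (sym (+-identityʳ 0#))) (+-interchange _ _ _ _)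
  ∑splits-+ (x ∷ xs) F G = trans (+-cong refl (∑splits-+ xs _ _)) (+-interchange _ _ _ _)

  *-distribˡ-∑splits : ∀ w k F → k * ∑splits w F ≈ ∑splits w (λ a b → k * F a b)
  *-distribˡ-∑splits []       k F = trans (distribˡ k _ _) (+-cong refl (zeroʳ k))
  *-distribˡ-∑splits (x ∷ xs) k F = trans (distribˡ k _ _) (+-cong refl (*-distribˡ-∑splits xs k _))

  *-distribʳ-∑splits : ∀ w F k → ∑splits w F * k ≈ ∑splits w (λ a b → F a b * k)
  *-distribʳ-∑splits []       F k = trans (distribʳ k _ _) (+-cong refl (zeroˡ k))
  *-distribʳ-∑splits (x ∷ xs) F k = trans (distribʳ k _ _) (+-cong refl (*-distribʳ-∑splits xs _ k))

  when-∑splits : ∀ b w F → when b (∑splits w F) ≈ ∑splits w (λ a c → when b (F a c))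
  when-∑splits true  w F = refl
  when-∑splits false w F = sym (∑splits-0 w)

  ∑triples : Word → (Word → Word → Word → Carrier) → Carrier
  ∑triples w G = ∑splits w (λ a₁ c → ∑splits c (G a₁))

  ∑splits-assoc : ∀ w (G : Word → Word → Word → Carrier) →
    ∑splits w (λ a b → ∑splits a (λ a₁ a₂ → G a₁ a₂ b)) ≈ ∑triples w G
  ∑splits-assoc []       G = refl
  ∑splits-assoc (x ∷ xs) G = begin
    (G [] [] (x ∷ xs) + 0#) + ∑splits xs (λ a b → G [] (x ∷ a) b + ∑splits a (λ a₁ a₂ → G (x ∷ a₁) a₂ b))
      ≈⟨ +-cong (+-identityʳ _) (∑splits-+ xs _ _) ⟩
    G [] [] (x ∷ xs) + (∑splits xs (G [] ∘′ (x ∷_)) + ∑splits xs (λ a b → ∑splits a (λ a₁ a₂ → G (x ∷ a₁) a₂ b)))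
      ≈⟨ +-cong refl (+-cong refl (∑splits-assoc xs (G ∘′ (x ∷_)))) ⟩
    G [] [] (x ∷ xs) + (∑splits xs (G [] ∘′ (x ∷_)) + ∑triples xs (G ∘′ (x ∷_)))
      ≈⟨ +-assoc _ _ _ ⟨
    (G [] [] (x ∷ xs) + ∑splits xs (G [] ∘′ (x ∷_))) + ∑triples xs (G ∘′ (x ∷_)) ∎

  opBy-cong : ∀ cond {x x′ y y′} → x ≈S x′ → y ≈S y′ → opBy cond x y ≈S opBy cond x′ y′
  opBy-cong cond {x} {x′} {y} {y′} x≈x′ y≈y′ w = begin
    opBy cond x y w
      ≡⟨ opBy-∑splits cond x y w ⟩
    ∑splits w (λ a b → when (cond a b) (x a * y b))
      ≈⟨ ∑splits-cong w (λ a b → when-cong (cond a b) (*-cong (x≈x′ a) (y≈y′ b))) ⟩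
    ∑splits w (λ a b → when (cond a b) (x′ a * y′ b))
      ≡⟨ opBy-∑splits cond x′ y′ w ⟨
    opBy cond x′ y′ w ∎

  opBy-linˡ : ∀ cond a b x y z →
    opBy cond ((a ·S x) +S (b ·S y)) z ≈S ((a ·S opBy cond x z) +S (b ·S opBy cond y z))
  opBy-linˡ cond a b x y z w = begin
    opBy cond ((a ·S x) +S (b ·S y)) z w
      ≡⟨ opBy-∑splits cond _ z w ⟩
    ∑splits w (λ u v → when (cond u v) ((a * x u + b * y u) * z v))
      ≈⟨ ∑splits-cong w (λ u v → pointwise (cond u v) (x u) (y u) (z v)) ⟩
    ∑splits w (λ u v → a * when (cond u v) (x u * z v) + b * when (cond u v) (y u * z v))
      ≈⟨ ∑splits-+ w _ _ ⟩
    ∑splits w (λ u v → a * when (cond u v) (x u * z v)) + ∑splits w (λ u v → b * when (cond u v) (y u * z v))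
      ≈⟨ +-cong (*-distribˡ-∑splits w a _) (*-distribˡ-∑splits w b _) ⟨
    a * ∑splits w (λ u v → when (cond u v) (x u * z v)) + b * ∑splits w (λ u v → when (cond u v) (y u * z v))
      ≡⟨ ≡.cong₂ (λ s t → a * s + b * t) (opBy-∑splits cond x z w) (opBy-∑splits cond y z w) ⟨
    a * opBy cond x z w + b * opBy cond y z w ∎
    where
    pointwise : ∀ d X Y Z → when d ((a * X + b * Y) * Z) ≈ a * when d (X * Z) + b * when d (Y * Z)
    pointwise true  X Y Z = trans (distribʳ Z (a * X) (b * Y)) (+-cong (*-assoc a X Z) (*-assoc b Y Z))
    pointwise false X Y Z = sym (trans (+-cong (zeroʳ a) (zeroʳ b)) (+-identityʳ 0#))

  opBy-linʳ : ∀ cond a b x y z →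
    opBy cond z ((a ·S x) +S (b ·S y)) ≈S ((a ·S opBy cond z x) +S (b ·S opBy cond z y))
  opBy-linʳ cond a b x y z w = begin
    opBy cond z ((a ·S x) +S (b ·S y)) w
      ≡⟨ opBy-∑splits cond z _ w ⟩
    ∑splits w (λ u v → when (cond u v) (z u * (a * x v + b * y v)))
      ≈⟨ ∑splits-cong w (λ u v → pointwise (cond u v) (x v) (y v) (z u)) ⟩
    ∑splits w (λ u v → a * when (cond u v) (z u * x v) + b * when (cond u v) (z u * y v))
      ≈⟨ ∑splits-+ w _ _ ⟩
    ∑splits w (λ u v → a * when (cond u v) (z u * x v)) + ∑splits w (λ u v → b * when (cond u v) (z u * y v))
      ≈⟨ +-cong (*-distribˡ-∑splits w a _) (*-distribˡ-∑splits w b _) ⟨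
    a * ∑splits w (λ u v → when (cond u v) (z u * x v)) + b * ∑splits w (λ u v → when (cond u v) (z u * y v))
      ≡⟨ ≡.cong₂ (λ s t → a * s + b * t) (opBy-∑splits cond z x w) (opBy-∑splits cond z y w) ⟨
    a * opBy cond z x w + b * opBy cond z y w ∎
    where
    *-swapˡ : ∀ Z k X → Z * (k * X) ≈ k * (Z * X)
    *-swapˡ Z k X = trans (sym (*-assoc Z k X)) (trans (*-cong (*-comm Z k) refl) (*-assoc k Z X))
    pointwise : ∀ d X Y Z → when d (Z * (a * X + b * Y)) ≈ a * when d (Z * X) + b * when d (Z * Y)
    pointwise true  X Y Z = trans (distribˡ Z (a * X) (b * Y)) (+-cong (*-swapˡ Z a X) (*-swapˡ Z b Y))
    pointwise false X Y Z = sym (trans (+-cong (zeroʳ a) (zeroʳ b)) (+-identityʳ 0#))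

  opBy-opByˡ : ∀ c₁ c₂ x y z w → opBy c₂ (opBy c₁ x y) z w ≈
    ∑triples w (λ a₁ a₂ b → when (c₂ (a₁ ++ a₂) b ∧ c₁ a₁ a₂) (x a₁ * (y a₂ * z b)))
  opBy-opByˡ c₁ c₂ x y z w = begin
    opBy c₂ (opBy c₁ x y) z w
      ≡⟨ opBy-∑splits c₂ _ z w ⟩
    ∑splits w (λ a b → when (c₂ a b) (opBy c₁ x y a * z b))
      ≈⟨ ∑splits-cong w (λ a b → when-cong (c₂ a b) (*-cong (reflexive (opBy-∑splits c₁ x y a)) refl)) ⟩
    ∑splits w (λ a b → when (c₂ a b) (∑splits a (λ a₁ a₂ → when (c₁ a₁ a₂) (x a₁ * y a₂)) * z b))
      ≈⟨ ∑splits-cong w (λ a b → trans (when-cong (c₂ a b) (*-distribʳ-∑splits a _ (z b)))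
                                        (when-∑splits (c₂ a b) a _)) ⟩
    ∑splits w (λ a b → ∑splits a (λ a₁ a₂ → when (c₂ a b) (when (c₁ a₁ a₂) (x a₁ * y a₂) * z b)))
      ≈⟨ ∑splits-cong w (λ a b → ∑splits-cong a (λ a₁ a₂ → when-nestˡ (c₂ a b) (c₁ a₁ a₂) (x a₁) (y a₂) (z b))) ⟩
    ∑splits w (λ a b → ∑splits a (λ a₁ a₂ → when (c₂ a b ∧ c₁ a₁ a₂) (xyz a₁ a₂ b)))
      ≈⟨ ∑splits-cong w (λ a b → ∑splits-++ a (λ a′ a₁ a₂ → when (c₂ a′ b ∧ c₁ a₁ a₂) (xyz a₁ a₂ b))) ⟩
    ∑splits w (λ a b → ∑splits a (λ a₁ a₂ → when (c₂ (a₁ ++ a₂) b ∧ c₁ a₁ a₂) (xyz a₁ a₂ b)))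
      ≈⟨ ∑splits-assoc w (λ a₁ a₂ b → when (c₂ (a₁ ++ a₂) b ∧ c₁ a₁ a₂) (xyz a₁ a₂ b)) ⟩
    ∑triples w (λ a₁ a₂ b → when (c₂ (a₁ ++ a₂) b ∧ c₁ a₁ a₂) (xyz a₁ a₂ b)) ∎
    where
    xyz : Word → Word → Word → Carrier
    xyz a₁ a₂ b = x a₁ * (y a₂ * z b)

  opBy-opByʳ : ∀ c₃ c₄ x y z w → opBy c₃ x (opBy c₄ y z) w ≈
    ∑triples w (λ a₁ a₂ b → when (c₃ a₁ (a₂ ++ b) ∧ c₄ a₂ b) (x a₁ * (y a₂ * z b)))
  opBy-opByʳ c₃ c₄ x y z w = begin
    opBy c₃ x (opBy c₄ y z) w
      ≡⟨ opBy-∑splits c₃ x _ w ⟩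
    ∑splits w (λ a c → when (c₃ a c) (x a * opBy c₄ y z c))
      ≈⟨ ∑splits-cong w (λ a c → when-cong (c₃ a c) (*-cong refl (reflexive (opBy-∑splits c₄ y z c)))) ⟩
    ∑splits w (λ a c → when (c₃ a c) (x a * ∑splits c (λ a₂ b → when (c₄ a₂ b) (y a₂ * z b))))
      ≈⟨ ∑splits-cong w (λ a c → trans (when-cong (c₃ a c) (*-distribˡ-∑splits c (x a) _))
                                        (when-∑splits (c₃ a c) c _)) ⟩
    ∑splits w (λ a c → ∑splits c (λ a₂ b → when (c₃ a c) (x a * when (c₄ a₂ b) (y a₂ * z b))))
      ≈⟨ ∑splits-cong w (λ a c → ∑splits-cong c (λ a₂ b → when-nestʳ (c₃ a c) (c₄ a₂ b) (x a) (y a₂) (z b))) ⟩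
    ∑splits w (λ a c → ∑splits c (λ a₂ b → when (c₃ a c ∧ c₄ a₂ b) (xyz a a₂ b)))
      ≈⟨ ∑splits-cong w (λ a c → ∑splits-++ c (λ c′ a₂ b → when (c₃ a c′ ∧ c₄ a₂ b) (xyz a a₂ b))) ⟩
    ∑triples w (λ a₁ a₂ b → when (c₃ a₁ (a₂ ++ b) ∧ c₄ a₂ b) (xyz a₁ a₂ b)) ∎
    where
    xyz : Word → Word → Word → Carrier
    xyz a₁ a₂ b = x a₁ * (y a₂ * z b)

  opBy-assoc : ∀ {c₁ c₂ c₃ c₄} → AssocCompatible c₁ c₂ c₃ c₄ →
    ∀ x y z → opBy c₂ (opBy c₁ x y) z ≈S opBy c₃ x (opBy c₄ y z)
  opBy-assoc {c₁} {c₂} {c₃} {c₄} compat x y z w = begin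
    opBy c₂ (opBy c₁ x y) z w
      ≈⟨ opBy-opByˡ c₁ c₂ x y z w ⟩
    ∑triples w (λ a₁ a₂ b → when (c₂ (a₁ ++ a₂) b ∧ c₁ a₁ a₂) (x a₁ * (y a₂ * z b)))
      ≈⟨ ∑splits-cong w (λ a₁ c → ∑splits-cong c (λ a₂ b →
           reflexive (≡.cong (λ t → when t (x a₁ * (y a₂ * z b))) (compat a₁ a₂ b)))) ⟩
    ∑triples w (λ a₁ a₂ b → when (c₃ a₁ (a₂ ++ b) ∧ c₄ a₂ b) (x a₁ * (y a₂ * z b)))
      ≈⟨ opBy-opByʳ c₃ c₄ x y z w ⟨
    opBy c₃ x (opBy c₄ y z) w ∎

  ⊙-byMax-always : ∀ x y → (x ⊙ y) ≈S opBy (byMax always) x y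
  ⊙-byMax-always x y w = begin
    (x ⊙ y) w
      ≡⟨ ≡.cong₂ _+_ (≡.cong₂ _+_ (opBy-∑splits condL x y w) (opBy-∑splits condC x y w))
                     (opBy-∑splits condR x y w) ⟩
    (∑splits w (L condL) + ∑splits w (L condC)) + ∑splits w (L condR)
      ≈⟨ trans (∑splits-+ w _ _) (+-cong (∑splits-+ w _ _) refl) ⟨
    ∑splits w (λ a b → (L condL a b + L condC a b) + L condR a b)
      ≈⟨ ∑splits-cong w (λ a b → trichotomy a b (x a * y b)) ⟩
    ∑splits w (L (byMax always))
      ≡⟨ opBy-∑splits (byMax always) x y w ⟨
    opBy (byMax always) x y w ∎
    where
    L : (Word → Word → Bool) → Word → Word → Carrier
    L cond a b = when (cond a b) (x a * y b)
    trichotomy : ∀ u v X →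
      (when (condL u v) X + when (condC u v) X) + when (condR u v) X ≈ when (byMax always u v) X
    trichotomy []      v       X = trans (+-identityʳ _) (+-identityʳ 0#)
    trichotomy (_ ∷ _) []      X = trans (+-identityʳ _) (+-identityʳ 0#)
    trichotomy (c ∷ u) (d ∷ v) X = when-trichotomy (maxW (c ∷ u)) (maxW (d ∷ v)) X

  InLimit-0 : InLimit 0S
  InLimit-0 n = 0 , λ _ _ _ → refl

  InLimit-+ : ∀ {f g} → InLimit f → InLimit g → InLimit (f +S g)
  InLimit-+ lf lg n with lf n | lg n
  ... | d₁ , f≈0 | d₂ , g≈0 = d₁ ⊔ d₂ , λ w w<n d<|w| →
    trans (+-cong (f≈0 w w<n (ℕP.≤-<-trans (ℕP.m≤m⊔n d₁ d₂) d<|w|))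
                  (g≈0 w w<n (ℕP.≤-<-trans (ℕP.m≤n⊔m d₁ d₂) d<|w|)))
          (+-identityʳ 0#)

  InLimit-· : ∀ k {f} → InLimit f → InLimit (k ·S f)
  InLimit-· k lf n with lf n
  ... | d , f≈0 = d , λ w w<n d<|w| → trans (*-cong refl (f≈0 w w<n d<|w|)) (zeroʳ k)

  -- A factorisation of a word longer than d₁ + d₂ has a left factor longer than d₁
  -- or a right factor longer than d₂.
  InLimit-opBy : ∀ cond {f g} → InLimit f → InLimit g → InLimit (opBy cond f g)
  InLimit-opBy cond {f} {g} lf lg n with lf n | lg n
  ... | d₁ , f≈0 | d₂ , g≈0 = d₁ ℕ.+ d₂ , λ w w<n d<|w| →
    trans (reflexive (opBy-∑splits cond f g w))
          (trans (∑splits-cong-on w (λ a b ab≡w → term≈0 a b ab≡w w<n d<|w|)) (∑splits-0 w))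
    where
    term≈0 : ∀ a b {w} → a ++ b ≡ w → All (ℕ._< n) w → d₁ ℕ.+ d₂ ℕ.< length w →
             when (cond a b) (f a * g b) ≈ 0#
    term≈0 a b ≡.refl ab<n d<|ab| with d₁ <? length a | d₂ <? length b
    ... | yes d₁<|a| | _ =
      when-zero (cond a b) (trans (*-cong (f≈0 a (AllP.++⁻ˡ a ab<n) d₁<|a|) refl) (zeroˡ (g b)))
    ... | no _ | yes d₂<|b| =
      when-zero (cond a b) (trans (*-cong refl (g≈0 b (AllP.++⁻ʳ a ab<n) d₂<|b|)) (zeroʳ (f a)))
    ... | no d₁≮|a| | no d₂≮|b| = ⊥-elim (ℕP.<⇒≱ d<|ab|
      (ℕP.≤-trans (ℕP.≤-reflexive (ListP.length-++ a)) (ℕP.+-mono-≤ (ℕP.≮⇒≥ d₁≮|a|) (ℕP.≮⇒≥ d₂≮|b|))))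

  InKA+-+ : ∀ {f g} → InKA+ f → InKA+ g → InKA+ (f +S g)
  InKA+-+ (lf , f[]≈0) (lg , g[]≈0) = InLimit-+ lf lg , trans (+-cong f[]≈0 g[]≈0) (+-identityʳ 0#)

  InKA+-· : ∀ k {f} → InKA+ f → InKA+ (k ·S f)
  InKA+-· k (lf , f[]≈0) = InLimit-· k lf , trans (*-cong refl f[]≈0) (zeroʳ k)

  InKA+-opBy : ∀ cond {f g} → InKA+ f → InKA+ g → InKA+ (opBy cond f g)
  InKA+-opBy cond (lf , f[]≈0) (lg , _) =
    InLimit-opBy cond lf lg ,
    trans (+-identityʳ _) (when-zero (cond [] []) (trans (*-cong f[]≈0 refl) (zeroˡ _)))

  byMax-assoc : ∀ r₁ r₂ r₃ r₄ → MaxCompatible r₁ r₂ r₃ r₄ →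
    ∀ x y z → opBy (byMax r₂) (opBy (byMax r₁) x y) z ≈S opBy (byMax r₃) x (opBy (byMax r₄) y z)
  byMax-assoc r₁ r₂ r₃ r₄ compat = opBy-assoc (byMax-assocCompatible r₁ r₂ r₃ r₄ compat)

  isDendriformTrialgebra : IsDendriformTrialgebraOn InKA+ _◁_ _∘_ _▷_
  isDendriformTrialgebra = record
    { P-0     = InLimit-0 , refl
    ; P-+     = InKA+-+
    ; P-·     = InKA+-·
    ; P-◁     = InKA+-opBy condL
    ; P-∘     = InKA+-opBy condC
    ; P-▷     = InKA+-opBy condR
    ; ◁-cong  = opBy-cong condL
    ; ∘-cong  = opBy-cong condC
    ; ▷-cong  = opBy-cong condR
    ; ◁-linˡ  = λ a b x y z _ _ _ → opBy-linˡ condL a b x y z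
    ; ◁-linʳ  = λ a b x y z _ _ _ → opBy-linʳ condL a b x y z
    ; ∘-linˡ  = λ a b x y z _ _ _ → opBy-linˡ condC a b x y z
    ; ∘-linʳ  = λ a b x y z _ _ _ → opBy-linʳ condC a b x y z
    ; ▷-linˡ  = λ a b x y z _ _ _ → opBy-linˡ condR a b x y z
    ; ▷-linʳ  = λ a b x y z _ _ _ → opBy-linʳ condR a b x y z
    ; ∘-assoc = λ x y z _ _ _ → byMax-assoc _≡ᵇ_ _≡ᵇ_ _≡ᵇ_ _≡ᵇ_ maxCompatible-∘-assoc x y z
    ; ax1     = λ x y z _ _ _ w → trans (byMax-assoc _>ᵇ_ _>ᵇ_ _>ᵇ_ always maxCompatible-ax1 x y z w)
                                        (sym (opBy-cong condL (λ _ → refl) (⊙-byMax-always y z) w))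
    ; ax2     = λ x y z _ _ _ → byMax-assoc _<ᵇ_ _>ᵇ_ _<ᵇ_ _>ᵇ_ maxCompatible-ax2 x y z
    ; ax3     = λ x y z _ _ _ w → trans (opBy-cong condR (⊙-byMax-always x y) (λ _ → refl) w)
                                        (byMax-assoc always _<ᵇ_ _<ᵇ_ _<ᵇ_ maxCompatible-ax3 x y z w)
    ; ax4     = λ x y z _ _ _ → byMax-assoc _<ᵇ_ _≡ᵇ_ _<ᵇ_ _≡ᵇ_ maxCompatible-ax4 x y z
    ; ax5     = λ x y z _ _ _ → byMax-assoc _>ᵇ_ _≡ᵇ_ _≡ᵇ_ _<ᵇ_ maxCompatible-ax5 x y z
    ; ax6     = λ x y z _ _ _ → byMax-assoc _≡ᵇ_ _>ᵇ_ _≡ᵇ_ _>ᵇ_ maxCompatible-ax6 x y z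
    }

mainTheorem20 : {c ℓ : Level} (K : CommutativeRing c ℓ) → IsField K → CharZero K →
    Series.IsDendriformTrialgebraOn K (Series.InKA+ K)
      (Series._◁_ K) (Series._∘_ K) (Series._▷_ K)
mainTheorem20 K _ _ = SeriesProperties.isDendriformTrialgebra K
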